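{- Let $T$ be a lattice triangle with first width $w_1$ and second width $w_2$. Then there is a triangle $T'\in\mathcal{S}_{w_1,w_2}$ which is affine equivalent to $T$, where $\mathcal{S}_{w_1,w_2}$ is defined as follows. If $w_1>0$, $\mathcal{S}_{w_1,w_2}$ consists of: (1) $T((0,0),(w_1,y_1),(0,w_2))$ for integers $y_1\ge0$ with $y_1\le r$, where $r\in\{0,\dots,w_1-1\}$ is the remainder of $w_2-y_1$ modulo $w_1$; (2) $T((0,0),(w_1,y_1),(x_2,w_2))$ for integers $0<x_2\le \frac{w_1}{2}$, $0\le y_1\le w_1-x_2$, with additionally $y_1\ge x_2$ if $w_1=w_2$; (3) when $w_1<w_2$, $T((0,y_0),(w_1,0),(x_2,w_2))$ for integers $1<x_2<\frac{w_1}{2}$, $0<y_0<x_2$. If $w_1=0$, $\mathcal{S}_{0,w_2}=\{T((0,0),(0,y_1),(0,w_2)): y_1\in\mathbb{Z},\ 0\le y_1\le\frac{w_2}{2}\}$.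
   Context: A lattice triangle $T=T(v_1,v_2,v_3)$ is the convex hull of three points $v_1,v_2,v_3\in\mathbb{Z}^2$ (recorded as a multiset; degenerate triangles allowed). Two lattice triangles are affine equivalent if some map $x\mapsto Ax+c$, $A\in\mathrm{GL}_2(\mathbb{Z})$, $c\in\mathbb{Z}^2$, maps the vertex multiset of one onto that of the other. For $u\in(\mathbb{Z}^2)^*$, $\operatorname{width}_u(T)=\max_{x\in T}u\cdot x-\min_{x\in T}u\cdot x$; choosing linearly independent $u_1,u_2\in(\mathbb{Z}^2)^*$ minimizing $(\operatorname{width}_{u_1}(T),\operatorname{width}_{u_2}(T))$ lexicographically, the first width is $\operatorname{width}_{u_1}(T)$ and the second width is $\operatorname{width}_{u_2}(T)$. Here $0\le w_1\le w_2$ are integers. -}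

module Defs where

open import Data.Nat using (ℕ; zero; suc)
open import Data.Integer
  using (ℤ; +_; _+_; _*_; -_; _-_; _≤_; _<_; _⊔_; _⊓_; _%ℕ_)
open import Data.Product using (_×_; _,_; Σ; ∃; ∃-syntax)
open import Data.Sum using (_⊎_)
open import Data.List using (List; []; _∷_)
open import Data.List.Relation.Binary.Permutation.Propositional using (_↭_)
open import Relation.Binary.PropositionalEquality using (_≡_; _≢_)

Point : Set
Point = ℤ × ℤ

Dual : Set
Dual = ℤ × ℤ

-- A lattice triangle T(v₁,v₂,v₃), recorded by its vertex triple
-- (degenerate triangles allowed); equality as multisets is handled
-- via permutations in the affine-equivalence relation below.
Triangle : Set
Triangle = Point × Point × Point

tri : Point → Point → Point → Triangle
tri a b c = a , b , c

vertices : Triangle → List Point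
vertices (a , b , c) = a ∷ b ∷ c ∷ []

_·_ : Dual → Point → ℤ
(u₁ , u₂) · (x , y) = u₁ * x + u₂ * y

-- width_u(T) = max_{x∈T} u·x − min_{x∈T} u·x ; a linear functional on the
-- convex hull attains its max/min at a vertex.
width : Dual → Triangle → ℤ
width u (a , b , c) = ((u · a) ⊔ (u · b) ⊔ (u · c)) - ((u · a) ⊓ (u · b) ⊓ (u · c))

det : ℤ × ℤ → ℤ × ℤ → ℤ
det (a , b) (c , d) = a * d - b * c

LinIndep : Dual → Dual → Set
LinIndep u v = det u v ≢ + 0

_≤lex_ : ℤ × ℤ → ℤ × ℤ → Set
(a , b) ≤lex (c , d) = (a < c) ⊎ ((a ≡ c) × (b ≤ d))

FirstSecondWidth : Triangle → ℕ → ℕ → Set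
FirstSecondWidth T w₁ w₂ =
  Σ Dual λ u₁ → Σ Dual λ u₂ →
    LinIndep u₁ u₂ × width u₁ T ≡ + w₁ × width u₂ T ≡ + w₂ ×
    ((v₁ v₂ : Dual) → LinIndep v₁ v₂ →
       (+ w₁ , + w₂) ≤lex (width v₁ T , width v₂ T))

Matrix : Set
Matrix = (ℤ × ℤ) × (ℤ × ℤ)

detM : Matrix → ℤ
detM (r₁ , r₂) = det r₁ r₂

InGL2 : Matrix → Set
InGL2 A = (detM A ≡ + 1) ⊎ (detM A ≡ - + 1)

affine : Matrix → Point → Point → Point
affine ((a , b) , (c , d)) (t₁ , t₂) (x , y) = (a * x + b * y + t₁ , c * x + d * y + t₂)

mapT : Matrix → Point → Triangle → Triangle
mapT A t (p , q , r) = affine A t p , affine A t q , affine A t r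

AffEquiv : Triangle → Triangle → Set
AffEquiv T T' = ∃[ A ] ∃[ t ] (InGL2 A × (vertices (mapT A t T) ↦ vertices T'))
  where
  _↦_ : List Point → List Point → Set
  _↦_ = _↭_

𝒮 : ℕ → ℕ → Triangle → Set
𝒮 zero w₂ T =
  ∃[ y₁ ] (+ 0 ≤ y₁ × (+ 2) * y₁ ≤ + w₂ ×
           T ≡ tri (+ 0 , + 0) (+ 0 , y₁) (+ 0 , + w₂))
𝒮 (suc k) w₂ T = S1 ⊎ (S2 ⊎ S3)
  where
  w₁ : ℕ
  w₁ = suc k
  S1 : Set
  S1 = ∃[ y₁ ] (+ 0 ≤ y₁ × y₁ ≤ + ((+ w₂ - y₁) %ℕ w₁) ×
                T ≡ tri (+ 0 , + 0) (+ w₁ , y₁) (+ 0 , + w₂))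
  S2 : Set
  S2 = ∃[ x₂ ] ∃[ y₁ ] (+ 0 < x₂ × (+ 2) * x₂ ≤ + w₁ ×
                       + 0 ≤ y₁ × y₁ ≤ + w₁ - x₂ ×
                       (w₁ ≡ w₂ → x₂ ≤ y₁) ×
                       T ≡ tri (+ 0 , + 0) (+ w₁ , y₁) (x₂ , + w₂))
  S3 : Set
  S3 = (+ w₁ < + w₂) ×
       ∃[ x₂ ] ∃[ y₀ ] (+ 1 < x₂ × (+ 2) * x₂ < + w₁ ×
                       + 0 < y₀ × y₀ < x₂ ×
                       T ≡ tri (+ 0 , y₀) (+ w₁ , + 0) (x₂ , + w₂))

-- Take the lexicographically minimal pair (u₁, u₂). The vector u₁ is a multiple of a
-- primitive u, which has width w₁ and extends to a unimodular basis (u, v); replacing v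
-- by v + k u, with k the quotient of det(u₂, v) by det(u, u₂), brings its width down to
-- w₂. In this basis the x- and y-widths of T are w₁ and w₂ and every (z, 1) has width
-- at least w₂. Reflections, a translation and a permutation of the vertices put a
-- vertex of least x and least y at the origin; the width bound for (−1, 1) then leaves
-- the triangles (0, 0), (W, y), (x, V) with x = 0 or x + y ≤ W, which shears, the
-- reflections x ↦ W − x and y ↦ V − y and, if W = V, transposition move into 𝒮.
module Submission where

open import Data.Nat as ℕ using (ℕ; zero; suc)
import Data.Nat.Properties as ℕ
import Data.Nat.Tactic.RingSolver as ℕ-Ring
import Data.Nat.DivMod as ℕ
open import Data.Nat.GCD using (module Bézout; module GCD)
open import Data.Nat.Divisibility using (divides)
open import Data.Integer hiding (suc; _/_; _%_)
open import Data.Integer.DivMod using (_/_; _%_; a≡a%n+[a/n]*n; n%d<d)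
open import Data.Integer.Properties
open import Data.Integer.Tactic.RingSolver
open import Data.List using (_∷_; [])
open import Data.List.Relation.Binary.Permutation.Propositional
  using (_↭_; ↭-reflexive; ↭-trans; ↭-refl; ↭-sym; swap; prep)
import Data.List.Relation.Binary.Permutation.Propositional.Properties as ↭
open import Data.Product using (_×_; _,_; proj₁; proj₂; ∃-syntax)
open import Data.Sum using (_⊎_; inj₁; inj₂)
open import Data.Empty using (⊥-elim)
open import Relation.Binary.PropositionalEquality
open import Relation.Binary.Definitions using (tri<; tri≈; tri>)
open import Relation.Nullary using (yes; no)
open import Defs

-- Linear inequalities are certified by writing the difference as a sum of terms
-- already known to be nonnegative; the ring solver checks the identity.
≤-by : ∀ {i j} k → 0ℤ ≤ k → j - i ≡ k → i ≤ j
≤-by k 0≤k eq = 0≤i-j⇒j≤i (subst (0ℤ ≤_) (sym eq) 0≤k)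

<-by : ∀ {i j} k → 0ℤ ≤ k → j - (1ℤ + i) ≡ k → i < j
<-by k 0≤k eq = suc[i]≤j⇒i<j (≤-by k 0≤k eq)

i<j⇒0≤j-[1+i] : ∀ {i j} → i < j → 0ℤ ≤ j - (1ℤ + i)
i<j⇒0≤j-[1+i] i<j = i≤j⇒0≤j-i (i<j⇒suc[i]≤j i<j)

0≤+ : ∀ n → 0ℤ ≤ + n
0≤+ n = +≤+ ℕ.z≤n

+-pres-0≤ : ∀ {i j} → 0ℤ ≤ i → 0ℤ ≤ j → 0ℤ ≤ i + j
+-pres-0≤ = +-mono-≤

i+j≤k⇒j≤k-i : ∀ i {j k} → i + j ≤ k → j ≤ k - i
i+j≤k⇒j≤k-i i {j} {k} i+j≤k = ≤-by _ (i≤j⇒0≤j-i i+j≤k) (regroup i j k)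
  where
  regroup : ∀ i j k → k - i - j ≡ k - (i + j)
  regroup = solve-∀

i≤j-k⇒k≤j-i : ∀ {i} j k → i ≤ j - k → k ≤ j - i
i≤j-k⇒k≤j-i {i} j k i≤j-k = ≤-by _ (i≤j⇒0≤j-i i≤j-k) (exchange i j k)
  where
  exchange : ∀ i j k → j - i - k ≡ j - k - i
  exchange = solve-∀

pos-∸ : ∀ {m n} → n ℕ.≤ m → + m - + n ≡ + (m ℕ.∸ n)
pos-∸ {m} {n} n≤m = trans (m-n≡m⊖n m n) (⊖-≥ n≤m)

cong₃ : ∀ {A B C D : Set} (f : A → B → C → D) {x y z x′ y′ z′} →
        x ≡ x′ → y ≡ y′ → z ≡ z′ → f x y z ≡ f x′ y′ z′
cong₃ f refl refl refl = refl

spread : ℤ → ℤ → ℤ → ℤ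
spread a b c = (a ⊔ b ⊔ c) - (a ⊓ b ⊓ c)

infix 4 _∈[_,_]

_∈[_,_] : ℤ → ℤ → ℤ → Set
x ∈[ lo , hi ] = lo ≤ x × x ≤ hi

spread-≤ : ∀ {a b c lo hi} → a ∈[ lo , hi ] → b ∈[ lo , hi ] → c ∈[ lo , hi ] →
           spread a b c ≤ hi - lo
spread-≤ (lo≤a , a≤hi) (lo≤b , b≤hi) (lo≤c , c≤hi) =
  +-mono-≤ (⊔-lub (⊔-lub a≤hi b≤hi) c≤hi) (neg-mono-≤ (⊓-glb (⊓-glb lo≤a lo≤b) lo≤c))

module _ (a b c : ℤ) where

  private
    lo = a ⊓ b ⊓ c
    hi = a ⊔ b ⊔ c

  ∈[min,max]₁ : a ∈[ lo , hi ]
  ∈[min,max]₁ = i≤j⇒i⊓k≤j c (i⊓j≤i a b) , i≤j⇒i≤j⊔k c (i≤i⊔j a b)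

  ∈[min,max]₂ : b ∈[ lo , hi ]
  ∈[min,max]₂ = i≤j⇒i⊓k≤j c (i⊓j≤j a b) , i≤j⇒i≤j⊔k c (i≤j⊔i a b)

  ∈[min,max]₃ : c ∈[ lo , hi ]
  ∈[min,max]₃ = i⊓j≤j (a ⊓ b) c , i≤j⊔i (a ⊔ b) c

spread-sorted : ∀ {a b c} → a ≤ b → b ≤ c → spread a b c ≡ c - a
spread-sorted {a} {b} {c} a≤b b≤c = ≤-antisym
  (spread-≤ (≤-refl , ≤-trans a≤b b≤c) (a≤b , b≤c) (≤-trans a≤b b≤c , ≤-refl))
  (+-mono-≤ (proj₂ (∈[min,max]₃ a b c)) (neg-mono-≤ (proj₁ (∈[min,max]₁ a b c))))

spread-≡0 : ∀ a b c → spread a b c ≡ 0ℤ → a ≡ b × a ≡ c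
spread-≡0 a b c eq = squeeze (∈[min,max]₁ a b c) (∈[min,max]₂ a b c) ,
                           squeeze (∈[min,max]₁ a b c) (∈[min,max]₃ a b c)
  where
  hi≡lo : a ⊔ b ⊔ c ≡ a ⊓ b ⊓ c
  hi≡lo = i-j≡0⇒i≡j _ _ eq
  squeeze : ∀ {x y} → x ∈[ a ⊓ b ⊓ c , a ⊔ b ⊔ c ] → y ∈[ a ⊓ b ⊓ c , a ⊔ b ⊔ c ] → x ≡ y
  squeeze (lo≤x , x≤hi) (lo≤y , y≤hi) = ≤-antisym
    (≤-trans x≤hi (≤-trans (≤-reflexive hi≡lo) lo≤y))
    (≤-trans y≤hi (≤-trans (≤-reflexive hi≡lo) lo≤x))

spread-swap₁₂ : ∀ a b c → spread b a c ≡ spread a b c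
spread-swap₁₂ a b c = cong₂ _-_ (cong (_⊔ c) (⊔-comm b a)) (cong (_⊓ c) (⊓-comm b a))

spread-swap₂₃ : ∀ a b c → spread a c b ≡ spread a b c
spread-swap₂₃ a b c = cong₂ _-_
  (trans (⊔-assoc a c b) (trans (cong (a ⊔_) (⊔-comm c b)) (sym (⊔-assoc a b c))))
  (trans (⊓-assoc a c b) (trans (cong (a ⊓_) (⊓-comm c b)) (sym (⊓-assoc a b c))))

module _ {f : ℤ → ℤ} (f-mono : ∀ {i j} → i < j → f i < f j) where

  spread-mono : ∀ a b c → spread (f a) (f b) (f c) ≡ f (a ⊔ b ⊔ c) - f (a ⊓ b ⊓ c)
  spread-mono a b c = cong₂ _-_
    (sym (trans (mono-<-distrib-⊔ f f-mono (a ⊔ b) c) (cong (_⊔ f c) (mono-<-distrib-⊔ f f-mono a b))))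
    (sym (trans (mono-<-distrib-⊓ f f-mono (a ⊓ b) c) (cong (_⊓ f c) (mono-<-distrib-⊓ f f-mono a b))))

spread-+ : ∀ a b c k → spread (a + k) (b + k) (c + k) ≡ spread a b c
spread-+ a b c k = trans (spread-mono (+-monoˡ-< k) a b c) (shift (a ⊔ b ⊔ c) (a ⊓ b ⊓ c))
  where
  shift : ∀ M m → (M + k) - (m + k) ≡ M - m
  shift M m = solve (M ∷ m ∷ k ∷ [])

spread-neg : ∀ a b c → spread (- a) (- b) (- c) ≡ spread a b c
spread-neg a b c = trans (cong₂ _-_ max-neg min-neg) (flip (a ⊔ b ⊔ c) (a ⊓ b ⊓ c))
  where
  flip : ∀ M m → - m - - M ≡ M - m
  flip M m = solve (M ∷ m ∷ [])
  max-neg : (- a) ⊔ (- b) ⊔ (- c) ≡ - (a ⊓ b ⊓ c)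
  max-neg = sym (trans (neg-distrib-⊓-⊔ (a ⊓ b) c) (cong (_⊔ (- c)) (neg-distrib-⊓-⊔ a b)))
  min-neg : (- a) ⊓ (- b) ⊓ (- c) ≡ - (a ⊔ b ⊔ c)
  min-neg = sym (trans (neg-distrib-⊔-⊓ (a ⊔ b) c) (cong (_⊓ (- c)) (neg-distrib-⊔-⊓ a b)))

spread-*ˡ : ∀ k a b c → spread (k * a) (k * b) (k * c) ≡ + ∣ k ∣ * spread a b c
spread-*ˡ (+ n) a b c = trans (cong₂ _-_ max-* min-*) (factor (+ n) (a ⊔ b ⊔ c) (a ⊓ b ⊓ c))
  where
  factor : ∀ k M m → k * M - k * m ≡ k * (M - m)
  factor k M m = solve (k ∷ M ∷ m ∷ [])
  max-* : (+ n * a) ⊔ (+ n * b) ⊔ (+ n * c) ≡ + n * (a ⊔ b ⊔ c)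
  max-* = sym (trans (*-distribˡ-⊔-nonNeg (+ n) (a ⊔ b) c) (cong (_⊔ (+ n * c)) (*-distribˡ-⊔-nonNeg (+ n) a b)))
  min-* : (+ n * a) ⊓ (+ n * b) ⊓ (+ n * c) ≡ + n * (a ⊓ b ⊓ c)
  min-* = sym (trans (*-distribˡ-⊓-nonNeg (+ n) (a ⊓ b) c) (cong (_⊓ (+ n * c)) (*-distribˡ-⊓-nonNeg (+ n) a b)))
spread-*ˡ k@(-[1+ n ]) a b c = begin
  spread (k * a) (k * b) (k * c)              ≡⟨ cong₃ spread (negate a) (negate b) (negate c) ⟩
  spread (- (m * a)) (- (m * b)) (- (m * c))  ≡⟨ spread-neg (m * a) (m * b) (m * c) ⟩
  spread (m * a) (m * b) (m * c)              ≡⟨ spread-*ˡ m a b c ⟩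
  m * spread a b c                            ∎
  where
  open ≡-Reasoning
  m = +[1+ n ]
  negate : ∀ x → k * x ≡ - (m * x)
  negate x = sym (neg-distribˡ-* m x)

spread-subadditive : ∀ a b c a′ b′ c′ →
  spread (a + a′) (b + b′) (c + c′) ≤ spread a b c + spread a′ b′ c′
spread-subadditive a b c a′ b′ c′ = subst (spread (a + a′) (b + b′) (c + c′) ≤_)
  (regroup (a ⊔ b ⊔ c) (a ⊓ b ⊓ c) (a′ ⊔ b′ ⊔ c′) (a′ ⊓ b′ ⊓ c′))
  (spread-≤ (add (∈[min,max]₁ a b c) (∈[min,max]₁ a′ b′ c′))
            (add (∈[min,max]₂ a b c) (∈[min,max]₂ a′ b′ c′))
            (add (∈[min,max]₃ a b c) (∈[min,max]₃ a′ b′ c′)))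
  where
  regroup : ∀ M m M′ m′ → (M + M′) - (m + m′) ≡ (M - m) + (M′ - m′)
  regroup M m M′ m′ = solve (M ∷ m ∷ M′ ∷ m′ ∷ [])
  add : ∀ {x y l h l′ h′} → x ∈[ l , h ] → y ∈[ l′ , h′ ] → x + y ∈[ l + l′ , h + h′ ]
  add (l≤x , x≤h) (l′≤y , y≤h′) = +-mono-≤ l≤x l′≤y , +-mono-≤ x≤h y≤h′

-- Widths of triangles

mapPoints : (Point → Point) → Triangle → Triangle
mapPoints F (p , q , r) = F p , F q , F r

swap₁₂ : Triangle → Triangle
swap₁₂ (p , q , r) = q , p , r

swap₂₃ : Triangle → Triangle
swap₂₃ (p , q , r) = p , r , q

width-mapPoints : ∀ F u v k → (∀ p → u · F p ≡ v · p + k) →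
                  ∀ T → width u (mapPoints F T) ≡ width v T
width-mapPoints F u v k u·F≡v·+k (p , q , r) =
  trans (cong₃ spread (u·F≡v·+k p) (u·F≡v·+k q) (u·F≡v·+k r)) (spread-+ (v · p) (v · q) (v · r) k)

width-swap₁₂ : ∀ u T → width u (swap₁₂ T) ≡ width u T
width-swap₁₂ u (p , q , r) = spread-swap₁₂ (u · p) (u · q) (u · r)

width-swap₂₃ : ∀ u T → width u (swap₂₃ T) ≡ width u T
width-swap₂₃ u (p , q , r) = spread-swap₂₃ (u · p) (u · q) (u · r)

infixr 7 _•_
infixl 6 _⊕_

_•_ : ℤ → Dual → Dual
k • (a , b) = k * a , k * b

_⊕_ : Dual → Dual → Dual
(a , b) ⊕ (c , d) = a + c , b + d

•-· : ∀ k u p → (k • u) · p ≡ k * (u · p)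
•-· k (a , b) (x , y) = expand k a b x y
  where
  expand : ∀ k a b x y → k * a * x + k * b * y ≡ k * (a * x + b * y)
  expand = solve-∀

⊕-· : ∀ u v p → (u ⊕ v) · p ≡ u · p + v · p
⊕-· (a , b) (c , d) (x , y) = expand a b c d x y
  where
  expand : ∀ a b c d x y → (a + c) * x + (b + d) * y ≡ a * x + b * y + (c * x + d * y)
  expand = solve-∀

width-• : ∀ k u T → width (k • u) T ≡ + ∣ k ∣ * width u T
width-• k u (p , q , r) =
  trans (cong₃ spread (•-· k u p) (•-· k u q) (•-· k u r)) (spread-*ˡ k (u · p) (u · q) (u · r))

width-⊕ : ∀ u v T → width (u ⊕ v) T ≤ width u T + width v T
width-⊕ u v (p , q , r) =
  subst (_≤ width u (p , q , r) + width v (p , q , r))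
        (sym (cong₃ spread (⊕-· u v p) (⊕-· u v q) (⊕-· u v r)))
        (spread-subadditive (u · p) (u · q) (u · r) (v · p) (v · q) (v · r))

width-neg : ∀ a b T → width (- a , - b) T ≡ width (a , b) T
width-neg a b (p , q , r) =
  trans (cong₃ spread (neg-· p) (neg-· q) (neg-· r)) (spread-neg ((a , b) · p) ((a , b) · q) ((a , b) · r))
  where
  neg-· : ∀ p → (- a , - b) · p ≡ - ((a , b) · p)
  neg-· (x , y) = expand a b x y
    where
    expand : ∀ a b x y → - a * x + - b * y ≡ - (a * x + b * y)
    expand = solve-∀

-- Affine equivalence

_∘ₘ_ : Matrix → Matrix → Matrix
((a , b) , (c , d)) ∘ₘ ((a′ , b′) , (c′ , d′)) =
  (a * a′ + b * c′ , a * b′ + b * d′) , (c * a′ + d * c′ , c * b′ + d * d′)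

affine-∘ : ∀ B s A t p → affine (B ∘ₘ A) (affine B s t) p ≡ affine B s (affine A t p)
affine-∘ ((a , b) , (c , d)) (s₁ , s₂) ((a′ , b′) , (c′ , d′)) (t₁ , t₂) (x , y) =
  cong₂ _,_ (row a b s₁) (row c d s₂)
  where
  row : ∀ a b s → (a * a′ + b * c′) * x + (a * b′ + b * d′) * y + (a * t₁ + b * t₂ + s)
                  ≡ a * (a′ * x + b′ * y + t₁) + b * (c′ * x + d′ * y + t₂) + s
  row a b s = solve (a ∷ b ∷ s ∷ a′ ∷ b′ ∷ c′ ∷ d′ ∷ t₁ ∷ t₂ ∷ x ∷ y ∷ [])

detM-∘ : ∀ B A → detM (B ∘ₘ A) ≡ detM B * detM A
detM-∘ ((a , b) , (c , d)) ((a′ , b′) , (c′ , d′)) = expand a b c d a′ b′ c′ d′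
  where
  expand : ∀ a b c d a′ b′ c′ d′ →
    (a * a′ + b * c′) * (c * b′ + d * d′) - (a * b′ + b * d′) * (c * a′ + d * c′)
    ≡ (a * d - b * c) * (a′ * d′ - b′ * c′)
  expand = solve-∀

InGL2-∘ : ∀ B A → InGL2 B → InGL2 A → InGL2 (B ∘ₘ A)
InGL2-∘ B A (inj₁ eB) (inj₁ eA) = inj₁ (trans (detM-∘ B A) (cong₂ _*_ eB eA))
InGL2-∘ B A (inj₁ eB) (inj₂ eA) = inj₂ (trans (detM-∘ B A) (cong₂ _*_ eB eA))
InGL2-∘ B A (inj₂ eB) (inj₁ eA) = inj₂ (trans (detM-∘ B A) (cong₂ _*_ eB eA))
InGL2-∘ B A (inj₂ eB) (inj₂ eA) = inj₁ (trans (detM-∘ B A) (cong₂ _*_ eB eA))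

affEquiv-trans : ∀ {T T′ T″} → AffEquiv T T′ → AffEquiv T′ T″ → AffEquiv T T″
affEquiv-trans {p , q , r} (A , t , A∈GL , π) (B , s , B∈GL , ρ) =
  B ∘ₘ A , affine B s t , InGL2-∘ B A B∈GL A∈GL ,
  ↭-trans (↭-reflexive (cong₃ (λ x y z → x ∷ y ∷ z ∷ [])
                                (affine-∘ B s A t p) (affine-∘ B s A t q) (affine-∘ B s A t r)))
          (↭-trans (↭.map⁺ (affine B s) π) ρ)

affEquiv-tri : ∀ A t {p q r p′ q′ r′} → InGL2 A →
  affine A t p ≡ p′ → affine A t q ≡ q′ → affine A t r ≡ r′ → AffEquiv (tri p q r) (tri p′ q′ r′)
affEquiv-tri A t A∈GL refl refl refl = A , t , A∈GL , ↭-refl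

affEquiv-↭ : ∀ {T T′} → vertices T ↭ vertices T′ → AffEquiv T T′
affEquiv-↭ {p , q , r} π =
  ((1ℤ , 0ℤ) , (0ℤ , 1ℤ)) , (0ℤ , 0ℤ) , inj₁ refl ,
  ↭-trans (↭-reflexive (cong₃ (λ x y z → x ∷ y ∷ z ∷ []) (identity p) (identity q) (identity r))) π
  where
  identity : ∀ p → affine ((1ℤ , 0ℤ) , (0ℤ , 1ℤ)) (0ℤ , 0ℤ) p ≡ p
  identity (x , y) = cong₂ _,_ (solve (x ∷ y ∷ [])) (solve (x ∷ y ∷ []))

affEquiv-mapPoints : ∀ A t {F} → InGL2 A → (∀ p → affine A t p ≡ F p) →
                     ∀ T → AffEquiv T (mapPoints F T)
affEquiv-mapPoints A t A∈GL affine≗F (p , q , r) = affEquiv-tri A t A∈GL (affine≗F p) (affine≗F q) (affine≗F r)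

↭-swap₁₂ : ∀ {A : Set} (a b c : A) → (a ∷ b ∷ c ∷ []) ↭ (b ∷ a ∷ c ∷ [])
↭-swap₁₂ a b c = swap a b ↭-refl

↭-swap₂₃ : ∀ {A : Set} (a b c : A) → (a ∷ b ∷ c ∷ []) ↭ (a ∷ c ∷ b ∷ [])
↭-swap₂₃ a b c = prep a (swap b c ↭-refl)

↭-reverse₃ : ∀ {A : Set} (a b c : A) → (a ∷ b ∷ c ∷ []) ↭ (c ∷ b ∷ a ∷ [])
↭-reverse₃ a b c = ↭-sym (↭.↭-reverse (a ∷ b ∷ c ∷ []))

Normalisable : ℕ → ℕ → Triangle → Set
Normalisable w₁ w₂ T = ∃[ T′ ] (𝒮 w₁ w₂ T′ × AffEquiv T T′)

normalisable-≃ : ∀ {w₁ w₂ T T′} → AffEquiv T T′ → Normalisable w₁ w₂ T′ → Normalisable w₁ w₂ T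
normalisable-≃ T≃T′ (T″ , T″∈𝒮 , T′≃T″) = T″ , T″∈𝒮 , affEquiv-trans T≃T′ T′≃T″

𝒮⇒normalisable : ∀ {w₁ w₂ T} → 𝒮 w₁ w₂ T → Normalisable w₁ w₂ T
𝒮⇒normalisable T∈𝒮 = _ , T∈𝒮 , affEquiv-↭ ↭-refl

origin : Point
origin = 0ℤ , 0ℤ

-- Normal forms of triangles with vertices (0, 0), (W, y), (x, V)

x-q*0≡x : ∀ q x → x - q * 0ℤ ≡ x
x-q*0≡x q x = trans (cong (_-_ x) (*-zeroʳ q)) (+-identityʳ x)

s1-shear : ∀ {W y V} q →
  AffEquiv (tri origin (W , y) (0ℤ , V)) (tri origin (W , y - q * W) (0ℤ , V))
s1-shear {W} {y} {V} q = affEquiv-tri ((1ℤ , 0ℤ) , (- q , 1ℤ)) origin (inj₁ refl)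
  (trans (image 0ℤ 0ℤ) (cong (0ℤ ,_) (x-q*0≡x q 0ℤ)))
  (image W y)
  (trans (image 0ℤ V) (cong (0ℤ ,_) (x-q*0≡x q V)))
  where
  image : ∀ x y → affine ((1ℤ , 0ℤ) , (- q , 1ℤ)) (0ℤ , 0ℤ) (x , y) ≡ (x , y - q * x)
  image x y = cong₂ _,_ (solve (x ∷ y ∷ [])) (solve (q ∷ x ∷ y ∷ []))

s1-flip : ∀ {W y V} →
  AffEquiv (tri origin (W , y) (0ℤ , V)) (tri origin (W , V - y) (0ℤ , V))
s1-flip {W} {y} {V} = affEquiv-trans
  (affEquiv-tri ((1ℤ , 0ℤ) , (0ℤ , -1ℤ)) (0ℤ , V) (inj₂ refl)
    (trans (image 0ℤ 0ℤ) (cong (0ℤ ,_) (+-identityʳ V)))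
    (image W y)
    (trans (image 0ℤ V) (cong (0ℤ ,_) (+-inverseʳ V))))
  (affEquiv-↭ (↭-reverse₃ _ _ _))
  where
  image : ∀ x y → affine ((1ℤ , 0ℤ) , (0ℤ , -1ℤ)) (0ℤ , V) (x , y) ≡ (x , V - y)
  image x y = cong₂ _,_ (solve (x ∷ y ∷ [])) (solve (x ∷ y ∷ V ∷ []))

[v∸m%n]%n≡[v∸m]%n : ∀ {v m} n .{{_ : ℕ.NonZero n}} → m ℕ.≤ v →
                     (v ℕ.∸ m ℕ.% n) ℕ.% n ≡ (v ℕ.∸ m) ℕ.% n
[v∸m%n]%n≡[v∸m]%n {v} {m} n m≤v = begin
  (v ℕ.∸ m ℕ.% n) ℕ.% n
    ≡⟨ cong (λ v → (v ℕ.∸ m ℕ.% n) ℕ.% n) (sym (ℕ.m∸n+n≡m m≤v)) ⟩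
  ((v ℕ.∸ m) ℕ.+ m ℕ.∸ m ℕ.% n) ℕ.% n
    ≡⟨ cong (ℕ._% n) (ℕ.+-∸-assoc (v ℕ.∸ m) (ℕ.m%n≤m m n)) ⟩
  ((v ℕ.∸ m) ℕ.+ (m ℕ.∸ m ℕ.% n)) ℕ.% n
    ≡⟨ cong (λ d → ((v ℕ.∸ m) ℕ.+ d) ℕ.% n) m∸m%n≡[m/n]*n ⟩
  ((v ℕ.∸ m) ℕ.+ (m ℕ./ n) ℕ.* n) ℕ.% n
    ≡⟨ ℕ.[m+kn]%n≡m%n (v ℕ.∸ m) (m ℕ./ n) n ⟩
  (v ℕ.∸ m) ℕ.% n
    ∎
  where
  open ≡-Reasoning
  m∸m%n≡[m/n]*n : m ℕ.∸ m ℕ.% n ≡ (m ℕ./ n) ℕ.* n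
  m∸m%n≡[m/n]*n = trans (cong (ℕ._∸ m ℕ.% n) (ℕ.m≡m%n+[m/n]*n m n)) (ℕ.m+n∸m≡n (m ℕ.% n) _)

module _ {k w₂ : ℕ} where

  private
    n = suc k

  s1-normalisable-by-shear : ∀ {m} → m ℕ.≤ w₂ → m ℕ.% n ℕ.≤ (w₂ ℕ.∸ m) ℕ.% n →
               Normalisable n w₂ (tri origin (+ n , + m) (0ℤ , + w₂))
  s1-normalisable-by-shear {m} m≤w₂ r≤r′ = normalisable-≃ (s1-shear (+ (m ℕ./ n)))
    (subst (λ y → Normalisable n w₂ (tri origin (+ n , y) (0ℤ , + w₂))) (sym m-[m/n]*n≡m%n)
      (𝒮⇒normalisable (inj₁ (+ (m ℕ.% n) , 0≤+ _ , +≤+ r≤[w₂-r]%n , refl))))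
    where
    r≤m : m ℕ.% n ℕ.≤ m
    r≤m = ℕ.m%n≤m m n
    m-[m/n]*n≡m%n : + m - + (m ℕ./ n) * + n ≡ + (m ℕ.% n)
    m-[m/n]*n≡m%n = begin
      + m - + (m ℕ./ n) * + n
        ≡⟨ cong (_-_ (+ m)) (sym (pos-* (m ℕ./ n) n)) ⟩
      + m - + ((m ℕ./ n) ℕ.* n)
        ≡⟨ pos-∸ (ℕ.≤-trans (ℕ.m≤n+m _ (m ℕ.% n)) (ℕ.≤-reflexive (sym m≡r+qn))) ⟩
      + (m ℕ.∸ (m ℕ./ n) ℕ.* n)
        ≡⟨ cong (λ x → + (x ℕ.∸ (m ℕ./ n) ℕ.* n)) m≡r+qn ⟩
      + (m ℕ.% n ℕ.+ (m ℕ./ n) ℕ.* n ℕ.∸ (m ℕ./ n) ℕ.* n)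
        ≡⟨ cong +_ (ℕ.m+n∸n≡m (m ℕ.% n) ((m ℕ./ n) ℕ.* n)) ⟩
      + (m ℕ.% n)
        ∎
      where
      open ≡-Reasoning
      m≡r+qn : m ≡ m ℕ.% n ℕ.+ (m ℕ./ n) ℕ.* n
      m≡r+qn = ℕ.m≡m%n+[m/n]*n m n
    r≤[w₂-r]%n : m ℕ.% n ℕ.≤ (+ w₂ - + (m ℕ.% n)) %ℕ n
    r≤[w₂-r]%n = subst (m ℕ.% n ℕ.≤_)
      (sym (trans (cong (_%ℕ n) (pos-∸ (ℕ.≤-trans r≤m m≤w₂))) ([v∸m%n]%n≡[v∸m]%n n m≤w₂)))
      r≤r′

  -- Shearing reduces y modulo W, and the flip y ↦ V − y exchanges y mod W with
  -- (V − y) mod W, so one of the two reductions satisfies the inequality of S1.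
  s1-normalisable : ∀ {y} → 0ℤ ≤ y → y ≤ + w₂ →
                    Normalisable n w₂ (tri origin (+ n , y) (0ℤ , + w₂))
  s1-normalisable {+ m} _ (+≤+ m≤w₂) with m ℕ.% n ℕ.≤? (w₂ ℕ.∸ m) ℕ.% n
  ... | yes r≤r′ = s1-normalisable-by-shear m≤w₂ r≤r′
  ... | no r≰r′ = normalisable-≃ s1-flip
    (subst (λ y → Normalisable n w₂ (tri origin (+ n , y) (0ℤ , + w₂))) (sym (pos-∸ m≤w₂))
      (s1-normalisable-by-shear (ℕ.m∸n≤m w₂ m) r′≤r))
    where
    r′≤r : (w₂ ℕ.∸ m) ℕ.% n ℕ.≤ (w₂ ℕ.∸ (w₂ ℕ.∸ m)) ℕ.% n
    r′≤r = subst (λ x → (w₂ ℕ.∸ m) ℕ.% n ℕ.≤ x ℕ.% n) (sym (ℕ.m∸[m∸n]≡n m≤w₂))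
                 (ℕ.<⇒≤ (ℕ.≰⇒> r≰r′))

transpose-≃ : ∀ {W x y} → AffEquiv (tri origin (W , y) (x , W)) (tri origin (W , x) (y , W))
transpose-≃ {W} {x} {y} = affEquiv-trans
  (affEquiv-tri ((0ℤ , 1ℤ) , (1ℤ , 0ℤ)) origin (inj₂ refl) refl (image W y) (image x W))
  (affEquiv-↭ (↭-swap₂₃ _ _ _))
  where
  image : ∀ a b → affine ((0ℤ , 1ℤ) , (1ℤ , 0ℤ)) (0ℤ , 0ℤ) (a , b) ≡ (b , a)
  image a b = cong₂ _,_ (solve (a ∷ b ∷ [])) (solve (a ∷ b ∷ []))

reflect-≃ : ∀ {W x y V} → AffEquiv (tri origin (W , y) (x , V)) (tri (0ℤ , y) (W , 0ℤ) (W - x , V))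
reflect-≃ {W} {x} {y} {V} = affEquiv-trans
  (affEquiv-tri ((-1ℤ , 0ℤ) , (0ℤ , 1ℤ)) (W , 0ℤ) (inj₂ refl)
    (trans (image 0ℤ 0ℤ) (cong (_, 0ℤ) (+-identityʳ W)))
    (trans (image W y) (cong (_, y) (+-inverseʳ W)))
    (image x V))
  (affEquiv-↭ (↭-swap₁₂ _ _ _))
  where
  image : ∀ a b → affine ((-1ℤ , 0ℤ) , (0ℤ , 1ℤ)) (W , 0ℤ) (a , b) ≡ (W - a , b)
  image a b = cong₂ _,_ (solve (a ∷ b ∷ W ∷ [])) (solve (a ∷ b ∷ []))

shear-≃ : ∀ {W x V} → AffEquiv (tri origin (W , W - x) (x , V)) (tri origin (W , x) (W - x , V))
shear-≃ {W} {x} {V} = affEquiv-trans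
  (affEquiv-tri ((-1ℤ , 0ℤ) , (-1ℤ , 1ℤ)) (W , x) (inj₂ refl) image₁ image₂ image₃)
  (affEquiv-↭ (↭-swap₁₂ _ _ _))
  where
  image : ∀ a b → affine ((-1ℤ , 0ℤ) , (-1ℤ , 1ℤ)) (W , x) (a , b) ≡ (W - a , b - a + x)
  image a b = cong₂ _,_ (solve (a ∷ b ∷ W ∷ [])) (solve (a ∷ b ∷ x ∷ []))
  image₁ : affine ((-1ℤ , 0ℤ) , (-1ℤ , 1ℤ)) (W , x) (0ℤ , 0ℤ) ≡ (W , x)
  image₁ = trans (image 0ℤ 0ℤ) (cong₂ _,_ (+-identityʳ W) (+-identityˡ x))
  image₂ : affine ((-1ℤ , 0ℤ) , (-1ℤ , 1ℤ)) (W , x) (W , W - x) ≡ (0ℤ , 0ℤ)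
  image₂ = trans (image W (W - x)) (cong₂ _,_ (+-inverseʳ W) (cancel W x))
    where
    cancel : ∀ W x → W - x - W + x ≡ 0ℤ
    cancel = solve-∀
  image₃ : affine ((-1ℤ , 0ℤ) , (-1ℤ , 1ℤ)) (W , x) (x , V) ≡ (W - x , V)
  image₃ = trans (image x V) (cong (W - x ,_) (cancel V x))
    where
    cancel : ∀ V x → V - x + x ≡ V
    cancel = solve-∀

module _ {k w₂ : ℕ} where

  private
    n = suc k
    W = + suc k

  s2-normalisable : ∀ {x y} → 0ℤ < x → + 2 * x ≤ W → 0ℤ ≤ y → y ≤ W - x →
                    Normalisable n w₂ (tri origin (W , y) (x , + w₂))
  s2-normalisable {x} {y} 0<x 2x≤W 0≤y y≤W-x with n ℕ.≟ w₂
  ... | no n≢w₂ =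
    𝒮⇒normalisable (inj₂ (inj₁ (x , y , 0<x , 2x≤W , 0≤y , y≤W-x , (λ n≡w₂ → ⊥-elim (n≢w₂ n≡w₂)) , refl)))
  ... | yes refl with x ≤? y
  ...   | yes x≤y =
    𝒮⇒normalisable (inj₂ (inj₁ (x , y , 0<x , 2x≤W , 0≤y , y≤W-x , (λ _ → x≤y) , refl)))
  ...   | no x≰y = normalisable-≃ transpose-≃ transposed
    where
    y<x : y < x
    y<x = ≰⇒> x≰y
    transposed : Normalisable n n (tri origin (W , x) (y , W))
    transposed with y ≤? 0ℤ
    ... | yes y≤0 = subst (λ y → Normalisable n n (tri origin (W , x) (y , W))) (≤-antisym 0≤y y≤0)
                      (s1-normalisable (<⇒≤ (≤-<-trans 0≤y y<x)) (0≤i-j⇒j≤i (≤-trans 0≤y y≤W-x)))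
    ... | no y≰0 = 𝒮⇒normalisable (inj₂ (inj₁ (y , x , ≰⇒> y≰0 ,
                      ≤-trans (*-monoˡ-≤-nonNeg (+ 2) (<⇒≤ y<x)) 2x≤W ,
                      <⇒≤ (≤-<-trans 0≤y y<x) , i≤j-k⇒k≤j-i W x y≤W-x , (λ _ → <⇒≤ y<x) , refl)))

  box-narrow : ∀ {x y} → n ℕ.≤ w₂ → 0ℤ ≤ x → + 2 * x ≤ W → 0ℤ ≤ y → y ≤ W - x →
               Normalisable n w₂ (tri origin (W , y) (x , + w₂))
  box-narrow {x} {y} n≤w₂ 0≤x 2x≤W 0≤y y≤W-x with <-cmp 0ℤ x
  ... | tri< 0<x _ _ = s2-normalisable 0<x 2x≤W 0≤y y≤W-x
  ... | tri≈ _ refl _ =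
    s1-normalisable 0≤y (≤-trans (≤-trans y≤W-x (≤-reflexive (+-identityʳ W))) (+≤+ n≤w₂))
  ... | tri> _ _ x<0 = ⊥-elim (<⇒≱ x<0 0≤x)

  -- For 2x > W, the cases y = 0 and y = W − x reduce to 2x ≤ W by x ↦ W − x and by a
  -- shear; strictly in between, x ↦ W − x lands in S3 if W < V and transposition in S2 if W = V.
  module _ {x y} (n≤w₂ : n ℕ.≤ w₂) (0≤y : 0ℤ ≤ y) (x+y≤W : x + y ≤ W) (W<2x : W < + 2 * x) where

    private
      y≤W-x : y ≤ W - x
      y≤W-x = i+j≤k⇒j≤k-i x x+y≤W
      0≤W-x : 0ℤ ≤ W - x
      0≤W-x = ≤-trans 0≤y y≤W-x
      0≤x : 0ℤ ≤ x
      0≤x = *-cancelˡ-≤-pos 0ℤ x (+ 2) (<⇒≤ (≤-<-trans (0≤+ n) W<2x))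
      W-[W-x]≡x : W - (W - x) ≡ x
      W-[W-x]≡x = involution W x
        where
        involution : ∀ W x → W - (W - x) ≡ x
        involution = solve-∀
      2[W-x]≤W : + 2 * (W - x) ≤ W
      2[W-x]≤W = ≤-by _ (+-pres-0≤ (i<j⇒0≤j-[1+i] W<2x) (0≤+ 1)) (regroup W x)
        where
        regroup : ∀ W x → W - + 2 * (W - x) ≡ + 2 * x - (1ℤ + W) + 1ℤ
        regroup = solve-∀

    box-wide : Normalisable n w₂ (tri origin (W , y) (x , + w₂))
    box-wide with <-cmp y 0ℤ | <-cmp y (W - x)
    ... | tri< y<0 _ _ | _ = ⊥-elim (<⇒≱ y<0 0≤y)
    ... | tri≈ _ refl _ | _ =
      normalisable-≃ reflect-≃
        (box-narrow n≤w₂ 0≤W-x 2[W-x]≤W ≤-refl (subst (0ℤ ≤_) (sym W-[W-x]≡x) 0≤x))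
    ... | tri> _ _ 0<y | tri> _ _ y>W-x = ⊥-elim (<⇒≱ y>W-x y≤W-x)
    ... | tri> _ _ 0<y | tri≈ _ refl _ =
      normalisable-≃ shear-≃ (box-narrow n≤w₂ 0≤W-x 2[W-x]≤W 0≤x (≤-reflexive (sym W-[W-x]≡x)))
    ... | tri> _ _ 0<y | tri< y<W-x _ _ with ℕ.m≤n⇒m<n∨m≡n n≤w₂
    ...   | inj₁ n<w₂ = normalisable-≃ reflect-≃
            (𝒮⇒normalisable (inj₂ (inj₂ (+<+ n<w₂ , W - x , y , 1<W-x , 2[W-x]<W , 0<y , y<W-x , refl))))
      where
      1<W-x : 1ℤ < W - x
      1<W-x = ≤-<-trans (i<j⇒suc[i]≤j 0<y) y<W-x
      2[W-x]<W : + 2 * (W - x) < W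
      2[W-x]<W = <-by _ (i<j⇒0≤j-[1+i] W<2x) (regroup W x)
        where
        regroup : ∀ W x → W - (1ℤ + + 2 * (W - x)) ≡ + 2 * x - (1ℤ + W)
        regroup = solve-∀
    ...   | inj₂ refl = normalisable-≃ transpose-≃
            (𝒮⇒normalisable (inj₂ (inj₁
              (y , x , 0<y , 2y≤W , 0≤x , i≤j-k⇒k≤j-i W x y≤W-x , (λ _ → y≤x) , refl))))
      where
      y-gap : 0ℤ ≤ W - x - (1ℤ + y)
      y-gap = i<j⇒0≤j-[1+i] y<W-x
      2y≤W : + 2 * y ≤ W
      2y≤W = ≤-by _ (+-pres-0≤ (+-pres-0≤ (+-pres-0≤ y-gap y-gap) (i<j⇒0≤j-[1+i] W<2x)) (0≤+ 3))
                    (regroup W x y)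
        where
        regroup : ∀ W x y → W - + 2 * y
                  ≡ (W - x - (1ℤ + y)) + (W - x - (1ℤ + y)) + (+ 2 * x - (1ℤ + W)) + + 3
        regroup = solve-∀
      y≤x : y ≤ x
      y≤x = ≤-by _ (+-pres-0≤ (+-pres-0≤ y-gap (i<j⇒0≤j-[1+i] W<2x)) (0≤+ 2)) (regroup W x y)
        where
        regroup : ∀ W x y → x - y ≡ (W - x - (1ℤ + y)) + (+ 2 * x - (1ℤ + W)) + + 2
        regroup = solve-∀

  box-normalisable : ∀ {x y} → n ℕ.≤ w₂ → 0ℤ ≤ x → 0ℤ ≤ y → x + y ≤ W →
                     Normalisable n w₂ (tri origin (W , y) (x , + w₂))
  box-normalisable {x} n≤w₂ 0≤x 0≤y x+y≤W with + 2 * x ≤? W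
  ... | yes 2x≤W = box-narrow n≤w₂ 0≤x 2x≤W 0≤y (i+j≤k⇒j≤k-i x x+y≤W)
  ... | no 2x≰W = box-wide n≤w₂ 0≤y x+y≤W (≰⇒> 2x≰W)

-- Reduced triangles and their symmetries

record Reduced (w₁ w₂ : ℕ) (T : Triangle) : Set where
  field
    width-x    : width (1ℤ , 0ℤ) T ≡ + w₁
    width-y    : width (0ℤ , 1ℤ) T ≡ + w₂
    width-skew : ∀ z → + w₂ ≤ width (z , 1ℤ) T
    w₁≤w₂      : w₁ ℕ.≤ w₂

Reduced⇒Normalisable : ℕ → ℕ → Triangle → Set
Reduced⇒Normalisable w₁ w₂ T = Reduced w₁ w₂ T → Normalisable w₁ w₂ T

record Symmetry (F : Triangle → Triangle) : Set where
  field
    equivalence       : ∀ T → AffEquiv T (F T)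
    preserves-reduced : ∀ {w₁ w₂ T} → Reduced w₁ w₂ T → Reduced w₁ w₂ (F T)

open Symmetry

reduced⇒normalisable-via : ∀ {F w₁ w₂} → Symmetry F → ∀ T →
  Reduced⇒Normalisable w₁ w₂ (F T) → Reduced⇒Normalisable w₁ w₂ T
reduced⇒normalisable-via F-sym T F[T]-ok R =
  normalisable-≃ (equivalence F-sym T) (F[T]-ok (preserves-reduced F-sym R))

_∘ₛ_ : ∀ {F G} → Symmetry F → Symmetry G → Symmetry (λ T → F (G T))
_∘ₛ_ {G = G} F-sym G-sym = record
  { equivalence       = λ T → affEquiv-trans (equivalence G-sym T) (equivalence F-sym (G T))
  ; preserves-reduced = λ R → preserves-reduced F-sym (preserves-reduced G-sym R)
  }

width-invariant-symmetry : ∀ {F} → (∀ T → AffEquiv T (F T)) → (∀ u T → width u (F T) ≡ width u T) →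
                           Symmetry F
width-invariant-symmetry {F} F-≃ F-width = record
  { equivalence       = F-≃
  ; preserves-reduced = λ {_} {_} {T} R → record
    { width-x    = trans (F-width (1ℤ , 0ℤ) T) (Reduced.width-x R)
    ; width-y    = trans (F-width (0ℤ , 1ℤ) T) (Reduced.width-y R)
    ; width-skew = λ z → subst (_ ≤_) (sym (F-width (z , 1ℤ) T)) (Reduced.width-skew R z)
    ; w₁≤w₂      = Reduced.w₁≤w₂ R
    }
  }

swap₁₂-symmetry : Symmetry swap₁₂
swap₁₂-symmetry = width-invariant-symmetry (λ { (p , q , r) → affEquiv-↭ (↭-swap₁₂ p q r) }) width-swap₁₂

swap₂₃-symmetry : Symmetry swap₂₃
swap₂₃-symmetry = width-invariant-symmetry (λ { (p , q , r) → affEquiv-↭ (↭-swap₂₃ p q r) }) width-swap₂₃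

translate : Point → Point → Point
translate (s , t) (x , y) = x + s , y + t

translate-symmetry : ∀ t → Symmetry (mapPoints (translate t))
translate-symmetry (s , t) = width-invariant-symmetry
  (affEquiv-mapPoints ((1ℤ , 0ℤ) , (0ℤ , 1ℤ)) (s , t) (inj₁ refl) image)
  (λ u → width-mapPoints (translate (s , t)) u u (u · (s , t)) (·-translate u))
  where
  image : ∀ p → affine ((1ℤ , 0ℤ) , (0ℤ , 1ℤ)) (s , t) p ≡ translate (s , t) p
  image (x , y) = cong₂ _,_ (solve (x ∷ y ∷ s ∷ [])) (solve (x ∷ y ∷ t ∷ []))
  ·-translate : ∀ u p → u · translate (s , t) p ≡ u · p + u · (s , t)
  ·-translate (a , b) (x , y) = expand a b x y s t
    where
    expand : ∀ a b x y s t → a * (x + s) + b * (y + t) ≡ a * x + b * y + (a * s + b * t)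
    expand = solve-∀

negateX : Point → Point
negateX (x , y) = - x , y

negateY : Point → Point
negateY (x , y) = x , - y

negateX-symmetry : Symmetry (mapPoints negateX)
negateX-symmetry = record
  { equivalence       = affEquiv-mapPoints ((-1ℤ , 0ℤ) , (0ℤ , 1ℤ)) (0ℤ , 0ℤ) (inj₂ refl) image
  ; preserves-reduced = λ {_} {_} {T} R → record
    { width-x    = trans (width-negateX 1ℤ 0ℤ T) (trans (width-neg 1ℤ 0ℤ T) (Reduced.width-x R))
    ; width-y    = trans (width-negateX 0ℤ 1ℤ T) (Reduced.width-y R)
    ; width-skew = λ z → subst (_ ≤_) (sym (width-negateX z 1ℤ T)) (Reduced.width-skew R (- z))
    ; w₁≤w₂      = Reduced.w₁≤w₂ R
    }
  }
  where
  image : ∀ p → affine ((-1ℤ , 0ℤ) , (0ℤ , 1ℤ)) (0ℤ , 0ℤ) p ≡ negateX p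
  image (x , y) = cong₂ _,_ (solve (x ∷ y ∷ [])) (solve (x ∷ y ∷ []))
  width-negateX : ∀ a b T → width (a , b) (mapPoints negateX T) ≡ width (- a , b) T
  width-negateX a b = width-mapPoints negateX (a , b) (- a , b) 0ℤ ·-negateX
    where
    ·-negateX : ∀ p → (a , b) · negateX p ≡ (- a , b) · p + 0ℤ
    ·-negateX (x , y) = expand a b x y
      where
      expand : ∀ a b x y → a * - x + b * y ≡ - a * x + b * y + 0ℤ
      expand = solve-∀

negateY-symmetry : Symmetry (mapPoints negateY)
negateY-symmetry = record
  { equivalence       = affEquiv-mapPoints ((1ℤ , 0ℤ) , (0ℤ , -1ℤ)) (0ℤ , 0ℤ) (inj₂ refl) image
  ; preserves-reduced = λ {_} {_} {T} R → record
    { width-x    = trans (width-negateY 1ℤ 0ℤ T) (Reduced.width-x R)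
    ; width-y    = trans (width-negateY 0ℤ 1ℤ T) (trans (width-neg 0ℤ 1ℤ T) (Reduced.width-y R))
    ; width-skew = λ z → subst (_ ≤_) (sym (trans (width-negateY z 1ℤ T) (width-neg-skew z T)))
                                      (Reduced.width-skew R (- z))
    ; w₁≤w₂      = Reduced.w₁≤w₂ R
    }
  }
  where
  image : ∀ p → affine ((1ℤ , 0ℤ) , (0ℤ , -1ℤ)) (0ℤ , 0ℤ) p ≡ negateY p
  image (x , y) = cong₂ _,_ (solve (x ∷ y ∷ [])) (solve (x ∷ y ∷ []))
  width-negateY : ∀ a b T → width (a , b) (mapPoints negateY T) ≡ width (a , - b) T
  width-negateY a b = width-mapPoints negateY (a , b) (a , - b) 0ℤ ·-negateY
    where
    ·-negateY : ∀ p → (a , b) · negateY p ≡ (a , - b) · p + 0ℤ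
    ·-negateY (x , y) = expand a b x y
      where
      expand : ∀ a b x y → a * x + b * - y ≡ a * x + - b * y + 0ℤ
      expand = solve-∀
  width-neg-skew : ∀ z T → width (z , -1ℤ) T ≡ width (- z , 1ℤ) T
  width-neg-skew z T = trans (cong (λ z → width (z , -1ℤ) T) (sym (neg-involutive z))) (width-neg (- z) 1ℤ T)

sort-vertices : (P : Triangle → Set) (key : Point → ℤ) →
  (∀ T → P (swap₁₂ T) → P T) → (∀ T → P (swap₂₃ T) → P T) →
  (∀ p q r → key p ≤ key q → key q ≤ key r → P (p , q , r)) → ∀ T → P T
sort-vertices P key P-swap₁₂ P-swap₂₃ P-sorted (p , q , r)
  with ≤-total (key p) (key q) | ≤-total (key q) (key r) | ≤-total (key p) (key r)
... | inj₁ p≤q | inj₁ q≤r | _       = P-sorted p q r p≤q q≤r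
... | inj₁ p≤q | inj₂ r≤q | inj₁ p≤r = P-swap₂₃ _ (P-sorted p r q p≤r r≤q)
... | inj₁ p≤q | inj₂ r≤q | inj₂ r≤p = P-swap₂₃ _ (P-swap₁₂ _ (P-sorted r p q r≤p p≤q))
... | inj₂ q≤p | inj₁ q≤r | inj₁ p≤r = P-swap₁₂ _ (P-sorted q p r q≤p p≤r)
... | inj₂ q≤p | inj₁ q≤r | inj₂ r≤p = P-swap₁₂ _ (P-swap₂₃ _ (P-sorted q r p q≤r r≤p))
... | inj₂ q≤p | inj₂ r≤q | _       = P-swap₁₂ _ (P-swap₂₃ _ (P-swap₁₂ _ (P-sorted r q p r≤q q≤p)))

module _ {k w₂ : ℕ} (n≤w₂ : suc k ℕ.≤ w₂) where

  private
    n = suc k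
    W = + suc k
    V = + w₂
    W≤V : W ≤ V
    W≤V = +≤+ n≤w₂
    0≤V-W : 0ℤ ≤ V - W
    0≤V-W = i≤j⇒0≤j-i W≤V

  -- The skew functional (−1, 1) has width at least V, which pins the second vertex
  -- to a corner of the box [0, W] × [0, V].
  corner-high : ∀ {c d} → 0ℤ ≤ c → c ≤ W → 0ℤ ≤ d → d ≤ V → V ≤ spread 0ℤ (d - c) (V - W) →
                Normalisable n w₂ (tri origin (c , d) (W , V))
  corner-high {c} {d} 0≤c c≤W 0≤d d≤V V≤skew with 0ℤ ≤? d - c
  ... | no d-c≱0 = subst₂ (λ c d → Normalisable n w₂ (tri origin (c , d) (W , V))) (sym c≡W) (sym d≡0)
        (box-normalisable n≤w₂ (0≤+ n) ≤-refl (≤-reflexive (+-identityʳ W)))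
    where
    d-c<0 : d - c < 0ℤ
    d-c<0 = ≰⇒> d-c≱0
    V≤bound : V ≤ V - W - (d - c)
    V≤bound = ≤-trans V≤skew (spread-≤ (<⇒≤ d-c<0 , 0≤V-W) (≤-refl , ≤-trans (<⇒≤ d-c<0) 0≤V-W)
                                       (≤-trans (<⇒≤ d-c<0) 0≤V-W , ≤-refl))
    c≡W : c ≡ W
    c≡W = ≤-antisym c≤W (≤-by _ (+-pres-0≤ (i≤j⇒0≤j-i V≤bound) 0≤d) (regroup V W c d))
      where
      regroup : ∀ V W c d → c - W ≡ V - W - (d - c) - V + d
      regroup = solve-∀
    d≡0 : d ≡ 0ℤ
    d≡0 = ≤-antisym (≤-by _ (+-pres-0≤ (i≤j⇒0≤j-i V≤bound) (i≤j⇒0≤j-i c≤W)) (regroup V W c d)) 0≤d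
      where
      regroup : ∀ V W c d → 0ℤ - d ≡ V - W - (d - c) - V + (W - c)
      regroup = solve-∀
  ... | yes 0≤d-c with d - c ≤? V - W
  ...   | yes d-c≤V-W = ⊥-elim (<⇒≱ V-W<V
            (≤-trans V≤skew (spread-≤ (≤-refl , 0≤V-W) (0≤d-c , d-c≤V-W) (0≤V-W , ≤-refl))))
    where
    V-W<V : V - W - 0ℤ < V
    V-W<V = <-by (+ k) (0≤+ k) (regroup V (+ k))
      where
      regroup : ∀ V k → V - (1ℤ + (V - (1ℤ + k) - 0ℤ)) ≡ k
      regroup = solve-∀
  ...   | no d-c≰V-W = subst₂ (λ c d → Normalisable n w₂ (tri origin (c , d) (W , V))) (sym c≡0) (sym d≡V)
          (normalisable-≃ (affEquiv-↭ (↭-swap₂₃ _ _ _)) (s1-normalisable (0≤+ w₂) ≤-refl))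
    where
    V≤d-c : V ≤ d - c - 0ℤ
    V≤d-c = ≤-trans V≤skew (spread-≤ (≤-refl , 0≤d-c) (0≤d-c , ≤-refl) (0≤V-W , <⇒≤ (≰⇒> d-c≰V-W)))
    c≡0 : c ≡ 0ℤ
    c≡0 = ≤-antisym (≤-by _ (+-pres-0≤ (i≤j⇒0≤j-i V≤d-c) (i≤j⇒0≤j-i d≤V)) (regroup V c d)) 0≤c
      where
      regroup : ∀ V c d → 0ℤ - c ≡ d - c - 0ℤ - V + (V - d)
      regroup = solve-∀
    d≡V : d ≡ V
    d≡V = ≤-antisym d≤V (≤-by _ (+-pres-0≤ (i≤j⇒0≤j-i V≤d-c) 0≤c) (regroup V c d))
      where
      regroup : ∀ V c d → d - V ≡ d - c - 0ℤ - V + c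
      regroup = solve-∀

  corner-low : ∀ {c f} → 0ℤ ≤ c → c ≤ W → 0ℤ ≤ f → f < V → V ≤ spread 0ℤ (V - c) (f - W) →
               Normalisable n w₂ (tri origin (c , V) (W , f))
  corner-low {c} {f} 0≤c c≤W 0≤f f<V V≤skew = normalisable-≃ (affEquiv-↭ (↭-swap₂₃ _ _ _)) swapped
    where
    0≤V-c : 0ℤ ≤ V - c
    0≤V-c = i≤j⇒0≤j-i (≤-trans c≤W W≤V)
    swapped : Normalisable n w₂ (tri origin (W , f) (c , V))
    swapped with f ≤? W
    ... | yes f≤W = box-normalisable n≤w₂ 0≤c 0≤f c+f≤W
      where
      f-W≤0 : f - W ≤ 0ℤ
      f-W≤0 = i≤j⇒i-j≤0 f≤W
      V≤bound : V ≤ V - c - (f - W)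
      V≤bound = ≤-trans V≤skew (spread-≤ (f-W≤0 , 0≤V-c) (≤-trans f-W≤0 0≤V-c , ≤-refl)
                                         (≤-refl , ≤-trans f-W≤0 0≤V-c))
      c+f≤W : c + f ≤ W
      c+f≤W = ≤-by _ (i≤j⇒0≤j-i V≤bound) (regroup V W c f)
        where
        regroup : ∀ V W c f → W - (c + f) ≡ V - c - (f - W) - V
        regroup = solve-∀
    ... | no f≰W = subst (λ c → Normalisable n w₂ (tri origin (W , f) (c , V))) (sym c≡0)
                     (s1-normalisable 0≤f (<⇒≤ f<V))
      where
      0≤f-W : 0ℤ ≤ f - W
      0≤f-W = i≤j⇒0≤j-i (<⇒≤ (≰⇒> f≰W))
      f-W≤V-c : f - W ≤ V - c
      f-W≤V-c = ≤-by _ (+-pres-0≤ (+-pres-0≤ (i<j⇒0≤j-[1+i] f<V) (i≤j⇒0≤j-i c≤W)) (0≤+ 1))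
                       (regroup V W c f)
        where
        regroup : ∀ V W c f → V - c - (f - W) ≡ V - (1ℤ + f) + (W - c) + 1ℤ
        regroup = solve-∀
      V≤V-c : V ≤ V - c - 0ℤ
      V≤V-c = ≤-trans V≤skew (spread-≤ (≤-refl , 0≤V-c) (0≤V-c , ≤-refl) (0≤f-W , f-W≤V-c))
      c≡0 : c ≡ 0ℤ
      c≡0 = ≤-antisym (≤-by _ (i≤j⇒0≤j-i V≤V-c) (regroup V c)) 0≤c
        where
        regroup : ∀ V c → 0ℤ - c ≡ V - c - 0ℤ - V
        regroup = solve-∀

spread-0-sorted : ∀ {a b} → 0ℤ ≤ a → a ≤ b → spread 0ℤ a b ≡ b
spread-0-sorted {a} {b} 0≤a a≤b = trans (spread-sorted 0≤a a≤b) (+-identityʳ b)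

width-x-vertices : ∀ a b c d e f → width (1ℤ , 0ℤ) ((a , b) , (c , d) , (e , f)) ≡ spread a c e
width-x-vertices a b c d e f = cong₃ spread (e₁· a b) (e₁· c d) (e₁· e f)
  where
  e₁· : ∀ x y → 1ℤ * x + 0ℤ * y ≡ x
  e₁· = solve-∀

width-y-vertices : ∀ a b c d e f → width (0ℤ , 1ℤ) ((a , b) , (c , d) , (e , f)) ≡ spread b d f
width-y-vertices a b c d e f = cong₃ spread (e₂· a b) (e₂· c d) (e₂· e f)
  where
  e₂· : ∀ x y → 0ℤ * x + 1ℤ * y ≡ y
  e₂· = solve-∀

width-skew-vertices : ∀ a b c d e f →
  width (-1ℤ , 1ℤ) ((a , b) , (c , d) , (e , f)) ≡ spread (b - a) (d - c) (f - e)
width-skew-vertices a b c d e f = cong₃ spread (skew· a b) (skew· c d) (skew· e f)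
  where
  skew· : ∀ x y → -1ℤ * x + 1ℤ * y ≡ y - x
  skew· = solve-∀

module _ {k w₂ : ℕ} where

  private
    n = suc k
    W = + suc k
    V = + w₂

  corner-at-origin : ∀ {c d e f} → 0ℤ ≤ c → c ≤ e → 0ℤ ≤ d → 0ℤ ≤ f →
                     Reduced⇒Normalisable n w₂ (tri origin (c , d) (e , f))
  corner-at-origin {c} {d} {e} {f} 0≤c c≤e 0≤d 0≤f R =
    subst (λ e → Normalisable n w₂ (tri origin (c , d) (e , f))) (sym e≡W) split-on-height
    where
    open Reduced R
    e≡W : e ≡ W
    e≡W = trans (sym (spread-0-sorted 0≤c c≤e)) (trans (sym (width-x-vertices 0ℤ 0ℤ c d e f)) width-x)
    c≤W : c ≤ W
    c≤W = ≤-trans c≤e (≤-reflexive e≡W)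
    height : spread 0ℤ d f ≡ V
    height = trans (sym (width-y-vertices 0ℤ 0ℤ c d e f)) width-y
    skew : V ≤ spread 0ℤ (d - c) (f - W)
    skew = subst (V ≤_) (trans (width-skew-vertices 0ℤ 0ℤ c d e f) (cong (λ e → spread 0ℤ (d - c) (f - e)) e≡W))
                 (width-skew -1ℤ)
    split-on-height : Normalisable n w₂ (tri origin (c , d) (W , f))
    split-on-height with d ≤? f
    ... | yes d≤f = subst (λ f → Normalisable n w₂ (tri origin (c , d) (W , f))) (sym f≡V)
                      (corner-high w₁≤w₂ 0≤c c≤W 0≤d (≤-trans d≤f (≤-reflexive f≡V))
                                   (subst (λ f → V ≤ spread 0ℤ (d - c) (f - W)) f≡V skew))
      where
      f≡V : f ≡ V
      f≡V = trans (sym (spread-0-sorted 0≤d d≤f)) height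
    ... | no d≰f = subst (λ d → Normalisable n w₂ (tri origin (c , d) (W , f))) (sym d≡V)
                     (corner-low w₁≤w₂ 0≤c c≤W 0≤f (<-≤-trans f<d (≤-reflexive d≡V))
                                 (subst (λ d → V ≤ spread 0ℤ (d - c) (f - W)) d≡V skew))
      where
      f<d : f < d
      f<d = ≰⇒> d≰f
      d≡V : d ≡ V
      d≡V = trans (sym (trans (spread-swap₂₃ 0ℤ f d) (spread-0-sorted 0≤f (<⇒≤ f<d)))) height

translate-to-origin : ∀ {w₁ w₂} a b c d e f →
  Reduced⇒Normalisable w₁ w₂ (tri origin (c - a , d - b) (e - a , f - b)) →
  Reduced⇒Normalisable w₁ w₂ (tri (a , b) (c , d) (e , f))
translate-to-origin {w₁} {w₂} a b c d e f at-origin =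
  reduced⇒normalisable-via (translate-symmetry (- a , - b)) (tri (a , b) (c , d) (e , f))
    (subst (λ p → Reduced⇒Normalisable w₁ w₂ (tri p (c - a , d - b) (e - a , f - b)))
           (sym (cong₂ _,_ (+-inverseʳ a) (+-inverseʳ b))) at-origin)

reverse-symmetry : Symmetry (λ T → swap₁₂ (swap₂₃ (swap₁₂ T)))
reverse-symmetry = swap₁₂-symmetry ∘ₛ (swap₂₃-symmetry ∘ₛ swap₁₂-symmetry)

lowest-of : ∀ b d f → (b ≤ d × b ≤ f) ⊎ (d ≤ b × d ≤ f) ⊎ (f ≤ b × f ≤ d)
lowest-of b d f with ≤-total b d | ≤-total b f | ≤-total d f
... | inj₁ b≤d | inj₁ b≤f | _        = inj₁ (b≤d , b≤f)
... | inj₁ b≤d | inj₂ f≤b | _        = inj₂ (inj₂ (f≤b , ≤-trans f≤b b≤d))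
... | inj₂ d≤b | _        | inj₁ d≤f = inj₂ (inj₁ (d≤b , d≤f))
... | inj₂ d≤b | _        | inj₂ f≤d = inj₂ (inj₂ (≤-trans f≤d d≤b , f≤d))

module _ {k w₂ : ℕ} where

  private
    n = suc k

  corner : ∀ {a b c d e f} → a ≤ c → c ≤ e → b ≤ d → b ≤ f →
           Reduced⇒Normalisable n w₂ (tri (a , b) (c , d) (e , f))
  corner {a} {b} {c} {d} {e} {f} a≤c c≤e b≤d b≤f = translate-to-origin a b c d e f
    (corner-at-origin (i≤j⇒0≤j-i a≤c) (+-monoˡ-≤ (- a) c≤e) (i≤j⇒0≤j-i b≤d) (i≤j⇒0≤j-i b≤f))

  -- A reflection makes the leftmost or the rightmost vertex also the lowest, unless the
  -- middle vertex is both the lowest and the highest, which makes the height 0.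
  x-sorted : ∀ {a b c d e f} → a ≤ c → c ≤ e → Reduced⇒Normalisable n w₂ (tri (a , b) (c , d) (e , f))
  x-sorted {a} {b} {c} {d} {e} {f} a≤c c≤e with lowest-of b d f | lowest-of (- b) (- d) (- f)
  ... | inj₁ (b≤d , b≤f) | _ = corner a≤c c≤e b≤d b≤f
  ... | inj₂ (inj₂ (f≤b , f≤d)) | _ =
    reduced⇒normalisable-via negateX-symmetry T (reduced⇒normalisable-via reverse-symmetry _
      (corner (neg-mono-≤ c≤e) (neg-mono-≤ a≤c) f≤d f≤b))
    where T = tri (a , b) (c , d) (e , f)
  ... | inj₂ (inj₁ _) | inj₁ (-b≤-d , -b≤-f) =
    reduced⇒normalisable-via negateY-symmetry T (corner a≤c c≤e -b≤-d -b≤-f)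
    where T = tri (a , b) (c , d) (e , f)
  ... | inj₂ (inj₁ _) | inj₂ (inj₂ (-f≤-b , -f≤-d)) =
    reduced⇒normalisable-via negateY-symmetry T (reduced⇒normalisable-via negateX-symmetry _
      (reduced⇒normalisable-via reverse-symmetry _ (corner (neg-mono-≤ c≤e) (neg-mono-≤ a≤c) -f≤-d -f≤-b)))
    where T = tri (a , b) (c , d) (e , f)
  ... | inj₂ (inj₁ (d≤b , d≤f)) | inj₂ (inj₁ (-d≤-b , -d≤-f)) = λ R →
    ⊥-elim (<⇒≱ (+<+ (ℕ.<-≤-trans (ℕ.s≤s ℕ.z≤n) (Reduced.w₁≤w₂ R))) (height≤0 R))
    where
    height≤0 : Reduced n w₂ (tri (a , b) (c , d) (e , f)) → + w₂ ≤ 0ℤ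
    height≤0 R = begin
      + w₂                                         ≡⟨ sym (Reduced.width-y R) ⟩
      width (0ℤ , 1ℤ) (tri (a , b) (c , d) (e , f)) ≡⟨ width-y-vertices a b c d e f ⟩
      spread b d f                                 ≤⟨ spread-≤ (d≤b , neg-cancel-≤ -d≤-b) (≤-refl , ≤-refl)
                                                               (d≤f , neg-cancel-≤ -d≤-f) ⟩
      d - d                                        ≡⟨ +-inverseʳ d ⟩
      0ℤ                                           ∎
      where open ≤-Reasoning

  reduced⇒normalisable-wide : ∀ T → Reduced⇒Normalisable n w₂ T
  reduced⇒normalisable-wide = sort-vertices (Reduced⇒Normalisable n w₂) proj₁
    (reduced⇒normalisable-via swap₁₂-symmetry) (reduced⇒normalisable-via swap₂₃-symmetry)
    (λ { (a , b) (c , d) (e , f) → x-sorted })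

module _ {w₂ : ℕ} where

  vertical-at-origin : ∀ {c d e f} → 0ℤ ≤ d → d ≤ f →
                       Reduced⇒Normalisable 0 w₂ (tri origin (c , d) (e , f))
  vertical-at-origin {c} {d} {e} {f} 0≤d d≤f R =
    subst₂ (λ c e → Normalisable 0 w₂ (tri origin (c , d) (e , f))) (proj₁ 0≡c×0≡e) (proj₂ 0≡c×0≡e)
      (subst (λ f → Normalisable 0 w₂ (tri origin (0ℤ , d) (0ℤ , f))) (sym f≡V) on-axis)
    where
    open Reduced R
    0≡c×0≡e : 0ℤ ≡ c × 0ℤ ≡ e
    0≡c×0≡e = spread-≡0 0ℤ c e (trans (sym (width-x-vertices 0ℤ 0ℤ c d e f)) width-x)
    f≡V : f ≡ + w₂
    f≡V = trans (sym (spread-0-sorted 0≤d d≤f)) (trans (sym (width-y-vertices 0ℤ 0ℤ c d e f)) width-y)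
    on-axis : Normalisable 0 w₂ (tri origin (0ℤ , d) (0ℤ , + w₂))
    on-axis with + 2 * d ≤? + w₂
    ... | yes 2d≤V = 𝒮⇒normalisable (d , 0≤d , 2d≤V , refl)
    ... | no 2d≰V = normalisable-≃ s1-flip
          (𝒮⇒normalisable (+ w₂ - d , i≤j⇒0≤j-i (≤-trans d≤f (≤-reflexive f≡V)) , 2[V-d]≤V , refl))
      where
      2[V-d]≤V : + 2 * (+ w₂ - d) ≤ + w₂
      2[V-d]≤V = ≤-by _ (+-pres-0≤ (i<j⇒0≤j-[1+i] (≰⇒> 2d≰V)) (0≤+ 1)) (regroup (+ w₂) d)
        where
        regroup : ∀ V d → V - + 2 * (V - d) ≡ + 2 * d - (1ℤ + V) + 1ℤ
        regroup = solve-∀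

  reduced⇒normalisable-flat : ∀ T → Reduced⇒Normalisable 0 w₂ T
  reduced⇒normalisable-flat = sort-vertices (Reduced⇒Normalisable 0 w₂) proj₂
    (reduced⇒normalisable-via swap₁₂-symmetry) (reduced⇒normalisable-via swap₂₃-symmetry)
    (λ { (a , b) (c , d) (e , f) b≤d d≤f → translate-to-origin a b c d e f
           (vertical-at-origin (i≤j⇒0≤j-i b≤d) (+-monoˡ-≤ (- b) d≤f)) })

reduced⇒normalisable : ∀ w₁ w₂ T → Reduced⇒Normalisable w₁ w₂ T
reduced⇒normalisable zero    w₂ = reduced⇒normalisable-flat
reduced⇒normalisable (suc k) w₂ = reduced⇒normalisable-wide

-- A reduced basis

LexMinimal : Triangle → ℕ → ℕ → Set
LexMinimal T w₁ w₂ = (v₁ v₂ : Dual) → LinIndep v₁ v₂ → (+ w₁ , + w₂) ≤lex (width v₁ T , width v₂ T)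

module _ {T w₁ w₂} (lex : LexMinimal T w₁ w₂) where

  lex-first : ∀ v₁ v₂ → LinIndep v₁ v₂ → + w₁ ≤ width v₁ T
  lex-first v₁ v₂ v₁⊥v₂ with lex v₁ v₂ v₁⊥v₂
  ... | inj₁ w₁<w = <⇒≤ w₁<w
  ... | inj₂ (w₁≡w , _) = ≤-reflexive w₁≡w

  lex-second : ∀ v₁ v₂ → LinIndep v₁ v₂ → width v₁ T ≡ + w₁ → + w₂ ≤ width v₂ T
  lex-second v₁ v₂ v₁⊥v₂ w≡w₁ with lex v₁ v₂ v₁⊥v₂
  ... | inj₁ w₁<w = ⊥-elim (<-irrefl (sym w≡w₁) w₁<w)
  ... | inj₂ (_ , w₂≤w) = w₂≤w

sign-decomposition : ∀ i → ∃[ σ ] (σ * σ ≡ 1ℤ × i ≡ σ * + ∣ i ∣)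
sign-decomposition (+ m)    = 1ℤ , refl , sym (*-identityˡ (+ m))
sign-decomposition -[1+ n ] = -1ℤ , refl , sym (-1*i≡-i +[1+ n ])

unimodular-from-identity : ∀ a b c d → 1ℤ + c * b ≡ d * a → a * d - b * c ≡ 1ℤ
unimodular-from-identity a b c d eq = begin
  a * d - b * c           ≡⟨ solve (a ∷ b ∷ c ∷ d ∷ []) ⟩
  d * a - c * b           ≡⟨ cong (_- c * b) (sym eq) ⟩
  1ℤ + c * b - c * b      ≡⟨ solve (b ∷ c ∷ []) ⟩
  1ℤ                      ∎
  where open ≡-Reasoning

cancel-common-factor : ∀ g m′ n′ x y .{{_ : ℕ.NonZero g}} →
  g ℕ.+ y ℕ.* (n′ ℕ.* g) ≡ x ℕ.* (m′ ℕ.* g) → 1ℤ + + y * + n′ ≡ + x * + m′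
cancel-common-factor g m′ n′ x y eq = begin
  1ℤ + + y * + n′        ≡⟨ cong (_+_ 1ℤ) (sym (pos-* y n′)) ⟩
  + (1 ℕ.+ y ℕ.* n′)     ≡⟨ cong +_ (ℕ.*-cancelʳ-≡ _ _ g
                                (trans (expand g y n′) (trans eq (regroup g x m′)))) ⟩
  + (x ℕ.* m′)           ≡⟨ pos-* x m′ ⟩
  + x * + m′             ∎
  where
  open ≡-Reasoning
  expand : ∀ g y n′ → (1 ℕ.+ y ℕ.* n′) ℕ.* g ≡ g ℕ.+ y ℕ.* (n′ ℕ.* g)
  expand = ℕ-Ring.solve-∀
  regroup : ∀ g x m′ → x ℕ.* (m′ ℕ.* g) ≡ x ℕ.* m′ ℕ.* g
  regroup = ℕ-Ring.solve-∀

bezout-cofactors : ∀ m n → ∃[ g ] ∃[ m′ ] ∃[ n′ ] ∃[ x ] ∃[ y ]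
  (m ≡ m′ ℕ.* g × n ≡ n′ ℕ.* g × + m′ * x - + n′ * y ≡ 1ℤ)
bezout-cofactors m n with Bézout.lemma m n
... | Bézout.result zero (GCD.is (divides m′ m≡m′*0 , divides n′ n≡n′*0) _) _ =
  0 , 1 , 0 , 1ℤ , 0ℤ , trans m≡m′*0 (ℕ.*-zeroʳ m′) , trans n≡n′*0 (ℕ.*-zeroʳ n′) , refl
... | Bézout.result g@(suc _) (GCD.is (divides m′ refl , divides n′ refl) _) (Bézout.+- x y g+yn≡xm) =
  g , m′ , n′ , + x , + y , refl , refl ,
  unimodular-from-identity (+ m′) (+ n′) (+ y) (+ x) (cancel-common-factor g m′ n′ x y g+yn≡xm)
... | Bézout.result g@(suc _) (GCD.is (divides m′ refl , divides n′ refl) _) (Bézout.-+ x y g+xm≡yn) =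
  g , m′ , n′ , - + x , - + y , refl , refl ,
  trans (negate-both (+ m′) (+ n′) (+ x) (+ y))
        (unimodular-from-identity (+ n′) (+ m′) (+ x) (+ y) (cancel-common-factor g n′ m′ y x g+xm≡yn))
  where
  negate-both : ∀ a b c d → a * - c - b * - d ≡ b * d - a * c
  negate-both = solve-∀

primitive-completion : ∀ u → ∃[ g ] ∃[ u′ ] ∃[ v ] (u ≡ + g • u′ × det u′ v ≡ 1ℤ)
primitive-completion (a , b)
  with sign-decomposition a | sign-decomposition b | bezout-cofactors ∣ a ∣ ∣ b ∣
... | σ , σσ≡1 , a≡σ∣a∣ | τ , ττ≡1 , b≡τ∣b∣ | g , m′ , n′ , x , y , ∣a∣≡m′g , ∣b∣≡n′g , m′x-n′y≡1 =
  g , (σ * + m′ , τ * + n′) , (τ * y , σ * x) ,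
  cong₂ _,_ (factor a σ m′ a≡σ∣a∣ ∣a∣≡m′g) (factor b τ n′ b≡τ∣b∣ ∣b∣≡n′g) ,
  (begin
    σ * + m′ * (σ * x) - τ * + n′ * (τ * y)   ≡⟨ regroup σ τ (+ m′) (+ n′) x y ⟩
    σ * σ * (+ m′ * x) - τ * τ * (+ n′ * y)   ≡⟨ cong₂ (λ s t → s * (+ m′ * x) - t * (+ n′ * y)) σσ≡1 ττ≡1 ⟩
    1ℤ * (+ m′ * x) - 1ℤ * (+ n′ * y)         ≡⟨ cong₂ _-_ (*-identityˡ (+ m′ * x)) (*-identityˡ (+ n′ * y)) ⟩
    + m′ * x - + n′ * y                       ≡⟨ m′x-n′y≡1 ⟩
    1ℤ                                        ∎)
  where
  open ≡-Reasoning
  regroup : ∀ σ τ m n x y → σ * m * (σ * x) - τ * n * (τ * y) ≡ σ * σ * (m * x) - τ * τ * (n * y)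
  regroup = solve-∀
  factor : ∀ i s m → i ≡ s * + ∣ i ∣ → ∣ i ∣ ≡ m ℕ.* g → i ≡ + g * (s * + m)
  factor i s m i≡s∣i∣ ∣i∣≡mg = begin
    i                   ≡⟨ i≡s∣i∣ ⟩
    s * + ∣ i ∣         ≡⟨ cong (λ k → s * + k) ∣i∣≡mg ⟩
    s * + (m ℕ.* g)     ≡⟨ cong (s *_) (pos-* m g) ⟩
    s * (+ m * + g)     ≡⟨ commute s (+ m) (+ g) ⟩
    + g * (s * + m)     ∎
    where
    commute : ∀ s m g → s * (m * g) ≡ g * (s * m)
    commute = solve-∀

≡1⇒≢0 : ∀ {i} → i ≡ 1ℤ → i ≢ 0ℤ
≡1⇒≢0 refl ()

det-shear : ∀ a b c d z → det (a , b) (z * a + c , z * b + d) ≡ det (a , b) (c , d)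
det-shear a b c d z = expand a b c d z
  where
  expand : ∀ a b c d z → a * (z * b + d) - b * (z * a + c) ≡ a * d - b * c
  expand = solve-∀

*-cancel-∣∣-≤ : ∀ β {i j} → β ≢ 0ℤ → + ∣ β ∣ * i ≤ + ∣ β ∣ * j → i ≤ j
*-cancel-∣∣-≤ (+ zero)   β≢0 _ = ⊥-elim (β≢0 refl)
*-cancel-∣∣-≤ +[1+ n ]   {i} {j} _ = *-cancelˡ-≤-pos i j +[1+ n ]
*-cancel-∣∣-≤ -[1+ n ]   {i} {j} _ = *-cancelˡ-≤-pos i j +[1+ n ]

module _ {T w₁ w₂} (lex : LexMinimal T w₁ w₂) (w₁≤w₂ : w₁ ℕ.≤ w₂) where

  -- In the basis (u, v) we have u₂ = α u + β v; dividing α = r + k β with 0 ≤ r < |β|,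
  -- e = k u + v satisfies β e = u₂ − r u, so |β| width e ≤ w₂ + r w₁ ≤ |β| w₂.
  second-basis-vector : ∀ u v u₂ → det u v ≡ 1ℤ → width u T ≡ + w₁ → LinIndep u u₂ → width u₂ T ≡ + w₂ →
                        ∃[ e ] (det u e ≡ 1ℤ × width e T ≡ + w₂)
  second-basis-vector u@(a , b) v@(c , d) u₂@(p , q) det[u,v]≡1 width-u u⊥u₂ width-u₂ =
    e , det[u,e]≡1 , ≤-antisym width-e≤w₂ (lex-second lex u e (≡1⇒≢0 det[u,e]≡1) width-u)
    where
    β = det u u₂
    α = det u₂ v
    instance
      β-nonZero : NonZero β
      β-nonZero = ≢-nonZero u⊥u₂
    r = α % β
    k = α / β
    e = k • u ⊕ v
    det[u,e]≡1 : det u e ≡ 1ℤ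
    det[u,e]≡1 = trans (det-shear a b c d k) det[u,v]≡1
    α-r-kβ≡0 : + r + k * β - α ≡ 0ℤ
    α-r-kβ≡0 = i≡j⇒i-j≡0 (sym (a≡a%n+[a/n]*n α β))
    det-1≡0 : a * d - b * c - 1ℤ ≡ 0ℤ
    det-1≡0 = i≡j⇒i-j≡0 det[u,v]≡1
    β•e≡u₂-r•u : β • e ≡ u₂ ⊕ (- + r) • u
    β•e≡u₂-r•u = cong₂ _,_
      (trans (expand₁ a b c d p q k (+ r)) (drop-zeros a p α-r-kβ≡0 det-1≡0))
      (trans (expand₂ a b c d p q k (+ r)) (drop-zeros b q α-r-kβ≡0 det-1≡0))
      where
      expand₁ : ∀ a b c d p q k r → (a * q - b * p) * (k * a + c)
                ≡ p + - r * a + a * (r + k * (a * q - b * p) - (p * d - q * c)) + p * (a * d - b * c - 1ℤ)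
      expand₁ = solve-∀
      expand₂ : ∀ a b c d p q k r → (a * q - b * p) * (k * b + d)
                ≡ q + - r * b + b * (r + k * (a * q - b * p) - (p * d - q * c)) + q * (a * d - b * c - 1ℤ)
      expand₂ = solve-∀
      drop-zeros : ∀ {x s t} y z → s ≡ 0ℤ → t ≡ 0ℤ → x + y * s + z * t ≡ x
      drop-zeros {x} y z refl refl = cancel x y z
        where
        cancel : ∀ x y z → x + y * 0ℤ + z * 0ℤ ≡ x
        cancel = solve-∀
    width-e≤w₂ : width e T ≤ + w₂
    width-e≤w₂ = *-cancel-∣∣-≤ β u⊥u₂ (begin
      + ∣ β ∣ * width e T                      ≡⟨ width-• β e T ⟨
      width (β • e) T                          ≡⟨ cong (λ w → width w T) β•e≡u₂-r•u ⟩
      width (u₂ ⊕ (- + r) • u) T               ≤⟨ width-⊕ u₂ ((- + r) • u) T ⟩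
      width u₂ T + width ((- + r) • u) T       ≡⟨ cong₂ _+_ width-u₂ (width-• (- + r) u T) ⟩
      + w₂ + + ∣ - + r ∣ * width u T           ≡⟨ cong₂ (λ m w → + w₂ + + m * w) (∣-i∣≡∣i∣ (+ r)) width-u ⟩
      + w₂ + + r * + w₁                        ≤⟨ +-monoʳ-≤ (+ w₂) (*-monoˡ-≤-nonNeg (+ r) (+≤+ w₁≤w₂)) ⟩
      + w₂ + + r * + w₂                        ≡⟨ regroup (+ r) (+ w₂) ⟩
      (1ℤ + + r) * + w₂                        ≤⟨ *-monoʳ-≤-nonNeg (+ w₂) (+≤+ (n%d<d α β)) ⟩
      + ∣ β ∣ * + w₂                           ∎)
      where
      open ≤-Reasoning
      regroup : ∀ r w → w + r * w ≡ (1ℤ + r) * w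
      regroup = solve-∀

width-mapT : ∀ r₁ r₂ z₁ z₂ T → width (z₁ , z₂) (mapT (r₁ , r₂) origin T) ≡ width (z₁ • r₁ ⊕ z₂ • r₂) T
width-mapT r₁@(a , b) r₂@(c , d) z₁ z₂ =
  width-mapPoints (affine (r₁ , r₂) origin) (z₁ , z₂) (z₁ • r₁ ⊕ z₂ • r₂) 0ℤ ·-image
  where
  ·-image : ∀ p → (z₁ , z₂) · affine (r₁ , r₂) origin p ≡ (z₁ • r₁ ⊕ z₂ • r₂) · p + 0ℤ
  ·-image (x , y) = expand a b c d z₁ z₂ x y
    where
    expand : ∀ a b c d z₁ z₂ x y → z₁ * (a * x + b * y + 0ℤ) + z₂ * (c * x + d * y + 0ℤ)
             ≡ (z₁ * a + z₂ * c) * x + (z₁ * b + z₂ * d) * y + 0ℤ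
    expand = solve-∀

module _ {T w₁ w₂} (lex : LexMinimal T w₁ w₂) (w₁≤w₂ : w₁ ℕ.≤ w₂) where

  reduced-in-basis : ∀ r₁ r₂ → det r₁ r₂ ≡ 1ℤ → width r₁ T ≡ + w₁ → width r₂ T ≡ + w₂ →
                     Reduced w₁ w₂ (mapT (r₁ , r₂) origin T)
  reduced-in-basis r₁@(a , b) r₂@(c , d) det≡1 width-r₁ width-r₂ = record
    { width-x    = trans (width-mapT r₁ r₂ 1ℤ 0ℤ T)
                         (trans (cong (λ u → width u T) (cong₂ _,_ (e₁ a c) (e₁ b d))) width-r₁)
    ; width-y    = trans (width-mapT r₁ r₂ 0ℤ 1ℤ T)
                         (trans (cong (λ u → width u T) (cong₂ _,_ (e₂ a c) (e₂ b d))) width-r₂)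
    ; width-skew = λ z → subst (_ ≤_) (sym (width-mapT r₁ r₂ z 1ℤ T))
                     (lex-second lex r₁ (z • r₁ ⊕ 1ℤ • r₂)
                       (≡1⇒≢0 (trans (det-shear a b (1ℤ * c) (1ℤ * d) z)
                                     (trans (cong₂ (λ c d → det r₁ (c , d)) (*-identityˡ c) (*-identityˡ d)) det≡1)))
                       width-r₁)
    ; w₁≤w₂      = w₁≤w₂
    }
    where
    e₁ : ∀ a c → 1ℤ * a + 0ℤ * c ≡ a
    e₁ = solve-∀
    e₂ : ∀ a c → 0ℤ * a + 1ℤ * c ≡ c
    e₂ = solve-∀

LinIndep-sym : ∀ u v → LinIndep u v → LinIndep v u
LinIndep-sym (a , b) (c , d) u⊥v det[v,u]≡0 = u⊥v (begin
  a * d - b * c      ≡⟨ antisymmetry a b c d ⟩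
  - (c * b - d * a)  ≡⟨ cong -_ det[v,u]≡0 ⟩
  0ℤ                 ∎)
  where
  open ≡-Reasoning
  antisymmetry : ∀ a b c d → a * d - b * c ≡ - (c * b - d * a)
  antisymmetry = solve-∀

LinIndep-•ˡ : ∀ k u v → LinIndep (k • u) v → LinIndep u v
LinIndep-•ˡ k (a , b) (c , d) ku⊥v det[u,v]≡0 = ku⊥v (begin
  k * a * d - k * b * c  ≡⟨ factor k a b c d ⟩
  k * (a * d - b * c)    ≡⟨ cong (k *_) det[u,v]≡0 ⟩
  k * 0ℤ                 ≡⟨ *-zeroʳ k ⟩
  0ℤ                     ∎)
  where
  open ≡-Reasoning
  factor : ∀ k a b c d → k * a * d - k * b * c ≡ k * (a * d - b * c)
  factor = solve-∀

i≤suc[n]*i : ∀ n {i} → 0ℤ ≤ i → i ≤ + suc n * i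
i≤suc[n]*i n {+ m} _ = ≤-trans (+≤+ (ℕ.m≤n*m m (suc n))) (≤-reflexive (pos-* (suc n) m))

module _ {T w₁ w₂} (lex : LexMinimal T w₁ w₂) where

  first≤second : ∀ u₁ u₂ → LinIndep u₁ u₂ → width u₂ T ≡ + w₂ → w₁ ℕ.≤ w₂
  first≤second u₁ u₂ u₁⊥u₂ width-u₂ =
    drop‿+≤+ (subst (+ w₁ ≤_) width-u₂ (lex-first lex u₂ u₁ (LinIndep-sym u₁ u₂ u₁⊥u₂)))

  width-primitive-part : ∀ g u u₂ → LinIndep u u₂ → width (+ suc g • u) T ≡ + w₁ → width u T ≡ + w₁
  width-primitive-part g u u₂ u⊥u₂ width-gu = ≤-antisym (begin
    width u T                     ≤⟨ i≤suc[n]*i g (≤-trans (0≤+ w₁) w₁≤width-u) ⟩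
    + suc g * width u T           ≡⟨ width-• (+ suc g) u T ⟨
    width (+ suc g • u) T         ≡⟨ width-gu ⟩
    + w₁                          ∎) w₁≤width-u
    where
    open ≤-Reasoning
    w₁≤width-u : + w₁ ≤ width u T
    w₁≤width-u = lex-first lex u u₂ u⊥u₂

  reduced-basis : ∀ u v u₂ → det u v ≡ 1ℤ → LinIndep u u₂ → width u T ≡ + w₁ → width u₂ T ≡ + w₂ →
                  w₁ ℕ.≤ w₂ → ∃[ A ] (detM A ≡ 1ℤ × Reduced w₁ w₂ (mapT A origin T))
  reduced-basis u v u₂ det[u,v]≡1 u⊥u₂ width-u width-u₂ w₁≤w₂ =
    (u , e) , det[u,e]≡1 , reduced-in-basis lex w₁≤w₂ u e det[u,e]≡1 width-u width-e
    where
    basis : ∃[ e ] (det u e ≡ 1ℤ × width e T ≡ + w₂)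
    basis = second-basis-vector lex w₁≤w₂ u v u₂ det[u,v]≡1 width-u u⊥u₂ width-u₂
    e : Dual
    e = proj₁ basis
    det[u,e]≡1 : det u e ≡ 1ℤ
    det[u,e]≡1 = proj₁ (proj₂ basis)
    width-e : width e T ≡ + w₂
    width-e = proj₂ (proj₂ basis)

  reduced-from-multiple : ∀ g u v u₂ → det u v ≡ 1ℤ → LinIndep (+ g • u) u₂ →
                          width (+ g • u) T ≡ + w₁ → width u₂ T ≡ + w₂ →
                          ∃[ A ] (detM A ≡ 1ℤ × Reduced w₁ w₂ (mapT A origin T))
  reduced-from-multiple zero    u v u₂ _ 0u⊥u₂ _ _ = ⊥-elim (0u⊥u₂ refl)
  reduced-from-multiple (suc g) u v u₂ det[u,v]≡1 gu⊥u₂ width-gu width-u₂ =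
    reduced-basis u v u₂ det[u,v]≡1 u⊥u₂ (width-primitive-part g u u₂ u⊥u₂ width-gu) width-u₂
                  (first≤second (+ suc g • u) u₂ gu⊥u₂ width-u₂)
    where
    u⊥u₂ : LinIndep u u₂
    u⊥u₂ = LinIndep-•ˡ (+ suc g) u u₂ gu⊥u₂

reduced-image : ∀ {T w₁ w₂} → FirstSecondWidth T w₁ w₂ →
                ∃[ A ] (detM A ≡ 1ℤ × Reduced w₁ w₂ (mapT A origin T))
reduced-image {T} {w₁} {w₂} (u₁ , u₂ , u₁⊥u₂ , width-u₁ , width-u₂ , lex) =
  reduced-from-multiple lex g u v u₂ det[u,v]≡1
    (subst (λ w → LinIndep w u₂) u₁≡g•u u₁⊥u₂) (subst (λ w → width w T ≡ + w₁) u₁≡g•u width-u₁)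
    width-u₂
  where
  completion : ∃[ g ] ∃[ u ] ∃[ v ] (u₁ ≡ + g • u × det u v ≡ 1ℤ)
  completion = primitive-completion u₁
  g : ℕ
  g = proj₁ completion
  u : Dual
  u = proj₁ (proj₂ completion)
  v : Dual
  v = proj₁ (proj₂ (proj₂ completion))
  u₁≡g•u : u₁ ≡ + g • u
  u₁≡g•u = proj₁ (proj₂ (proj₂ (proj₂ completion)))
  det[u,v]≡1 : det u v ≡ 1ℤ
  det[u,v]≡1 = proj₂ (proj₂ (proj₂ (proj₂ completion)))

proposition3p1 : (T : Triangle) (w₁ w₂ : ℕ) → FirstSecondWidth T w₁ w₂ →
    ∃[ T' ] (𝒮 w₁ w₂ T' × AffEquiv T T')
proposition3p1 T w₁ w₂ H =
  normalisable-≃ (A , origin , inj₁ detA≡1 , ↭-refl) (reduced⇒normalisable w₁ w₂ (mapT A origin T) reduced)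
  where
  image : ∃[ A ] (detM A ≡ 1ℤ × Reduced w₁ w₂ (mapT A origin T))
  image = reduced-image H
  A : Matrix
  A = proj₁ image
  detA≡1 : detM A ≡ 1ℤ
  detA≡1 = proj₁ (proj₂ image)
  reduced : Reduced w₁ w₂ (mapT A origin T)
  reduced = proj₂ (proj₂ image)
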